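{- $\Gamma \models \bigvee \Delta$ implies $\vdash_{\mathsf{GT}^- } \Gamma \Rightarrow \Delta$.
   Context: Classical formulas: $\alpha::=p\mid\bot\mid\neg\alpha\mid\alpha\wedge\alpha\mid\alpha\vee\alpha$; formulas of $\mathbf{PL}(\mathbin{\backslash\!\!\!/})$: $\phi::=\alpha\mid\phi\wedge\phi\mid\phi\vee\phi\mid\phi\mathbin{\backslash\!\!\!/}\phi$ ($\vee$ split disjunction, $\mathbin{\backslash\!\!\!/}$ inquisitive disjunction). Team semantics: a team is a set $t$ of valuations; $t\models p$ iff $v(p)=1$ for all $v\in t$; $t\models\bot$ iff $t=\emptyset$; $t\models\neg\alpha$ iff $\{v\}\not\models\alpha$ for all $v\in t$; $t\models\phi\wedge\psi$ iff both hold; $t\models\phi\vee\psi$ iff $t=s\cup u$ with $s\models\phi$, $u\models\psi$; $t\models\phi\mathbin{\backslash\!\!\!/}\psi$ iff $t\models\phi$ or $t\models\psi$; $\Gamma\models\phi$ iff every team satisfying all of $\Gamma$ satisfies $\phi$; $\bigvee\emptyset:=\bot$. $\mathsf{GT}^-$ is the cut-free calculus ($\alpha$ classical, $\Lambda$ a multiset of classical formulas) with axioms $\Gamma,p\Rightarrow p,\Delta$, $\Gamma,\bot\Rightarrow\Delta$ and rules $\mathsf{L}\neg$ ($\Gamma\Rightarrow\alpha,\Delta$ / $\Gamma,\neg\alpha\Rightarrow\Delta$), $\mathsf{R}\neg$ ($\Gamma,\alpha\Rightarrow\Delta$ / $\Gamma\Rightarrow\neg\alpha,\Delta$), $\mathsf{L}\wedge$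 ($\Gamma,\phi,\psi\Rightarrow\Delta$ / $\Gamma,\phi\wedge\psi\Rightarrow\Delta$), $\mathsf{R}\wedge$ ($\Gamma\Rightarrow\phi,\Lambda$ and $\Gamma\Rightarrow\psi,\Lambda$ / $\Gamma\Rightarrow\phi\wedge\psi,\Lambda,\Delta$), $\mathsf{L}\vee$ ($\Gamma,\phi\Rightarrow\Lambda$ and $\Gamma,\psi\Rightarrow\Lambda$ / $\Gamma,\phi\vee\psi\Rightarrow\Lambda,\Delta$), $\mathsf{R}\vee$ ($\Gamma\Rightarrow\phi,\psi,\Delta$ / $\Gamma\Rightarrow\phi\vee\psi,\Delta$), $\mathsf{L}\mathbin{\backslash\!\!\!/}$ ($\Gamma,\chi\{\phi_L\}\Rightarrow\Delta$ and $\Gamma,\chi\{\phi_R\}\Rightarrow\Delta$ / $\Gamma,\chi\{\phi_L\mathbin{\backslash\!\!\!/}\phi_R\}\Rightarrow\Delta$), $\mathsf{R}\mathbin{\backslash\!\!\!/}$ ($\Gamma\Rightarrow\chi\{\phi_i\},\Delta$, $i\in\{L,R\}$ / $\Gamma\Rightarrow\chi\{\phi_L\mathbin{\backslash\!\!\!/}\phi_R\},\Delta$), where $\chi\{\eta\}$ replaces a fixed subformula occurrence of $\chi$ not in the scope of a negation by $\eta$. -}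

module Defs where

open import Data.Nat using (ℕ)
open import Data.Bool using (Bool; true)
open import Data.Empty using (⊥)
open import Data.Sum using (_⊎_)
open import Data.Product using (_×_; Σ)
open import Data.List using (List; []; _∷_; _++_)
open import Data.List.Relation.Unary.All using (All)
open import Data.List.Membership.Propositional using (_∈_)
open import Data.List.Relation.Binary.Permutation.Propositional using (_↭_)
open import Relation.Binary.PropositionalEquality using (_≡_)
open import Relation.Nullary using (¬_)
open import Function.Bundles using (_⇔_)
open import Level using (Lift)

-- Propositional variables are natural numbers.
-- One syntax for PL(⩔); `neg` is only meant for classical formulas (see WF).
data Fm : Set where
  var  : ℕ → Fm
  bot  : Fm
  neg  : Fm → Fm
  _∧'_ : Fm → Fm → Fm
  _∨'_ : Fm → Fm → Fm
  _⩔_  : Fm → Fm → Fm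

data Classical : Fm → Set where
  c-var : ∀ p → Classical (var p)
  c-bot : Classical bot
  c-neg : ∀ {α} → Classical α → Classical (neg α)
  c-and : ∀ {α β} → Classical α → Classical β → Classical (α ∧' β)
  c-or  : ∀ {α β} → Classical α → Classical β → Classical (α ∨' β)

data WF : Fm → Set where
  w-var : ∀ p → WF (var p)
  w-bot : WF bot
  w-neg : ∀ {α} → Classical α → WF (neg α)
  w-and : ∀ {φ ψ} → WF φ → WF ψ → WF (φ ∧' ψ)
  w-or  : ∀ {φ ψ} → WF φ → WF ψ → WF (φ ∨' ψ)
  w-ior : ∀ {φ ψ} → WF φ → WF ψ → WF (φ ⩔ ψ)

Valuation : Set
Valuation = ℕ → Bool

Team : Set₁
Team = Valuation → Set

singleton : Valuation → Team
singleton v w = ∀ n → w n ≡ v n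

_⊨_ : Team → Fm → Set₁
t ⊨ var p    = Lift _ (∀ v → t v → v p ≡ true)
t ⊨ bot      = Lift _ (∀ v → ¬ t v)
t ⊨ neg α    = ∀ v → t v → ¬ (singleton v ⊨ α)
t ⊨ (φ ∧' ψ) = (t ⊨ φ) × (t ⊨ ψ)
t ⊨ (φ ∨' ψ) = Σ Team λ s → Σ Team λ u →
                 (∀ v → t v ⇔ (s v ⊎ u v)) × (s ⊨ φ) × (u ⊨ ψ)
t ⊨ (φ ⩔ ψ)  = (t ⊨ φ) ⊎ (t ⊨ ψ)

⋁ : List Fm → Fm
⋁ []           = bot
⋁ (φ ∷ [])     = φ
⋁ (φ ∷ ψ ∷ Δ)  = φ ∨' ⋁ (ψ ∷ Δ)

_⊨ˢ_ : List Fm → Fm → Set₁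
Γ ⊨ˢ φ = (t : Team) → (∀ γ → γ ∈ Γ → t ⊨ γ) → t ⊨ φ

-- Contexts χ{·}: a single hole not in the scope of a negation

data Ctx : Set where
  hole : Ctx
  _∧ˡ_ : Ctx → Fm → Ctx
  _∧ʳ_ : Fm → Ctx → Ctx
  _∨ˡ_ : Ctx → Fm → Ctx
  _∨ʳ_ : Fm → Ctx → Ctx
  _⩔ˡ_ : Ctx → Fm → Ctx
  _⩔ʳ_ : Fm → Ctx → Ctx

plug : Ctx → Fm → Fm
plug hole η     = η
plug (χ ∧ˡ ψ) η = plug χ η ∧' ψ
plug (φ ∧ʳ χ) η = φ ∧' plug χ η
plug (χ ∨ˡ ψ) η = plug χ η ∨' ψ
plug (φ ∨ʳ χ) η = φ ∨' plug χ η
plug (χ ⩔ˡ ψ) η = plug χ η ⩔ ψ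
plug (φ ⩔ʳ χ) η = φ ⩔ plug χ η

-- The cut-free calculus GT⁻.  Sequents are pairs of multisets, represented
-- as lists identified up to permutation (rule `perm`); principal formulas
-- are written at the head.

data GT⁻ : List Fm → List Fm → Set where
  perm  : ∀ {Γ Γ' Δ Δ'} → Γ ↭ Γ' → Δ ↭ Δ' → GT⁻ Γ Δ → GT⁻ Γ' Δ'
  ax    : ∀ {Γ Δ} p → GT⁻ (var p ∷ Γ) (var p ∷ Δ)
  ax⊥   : ∀ {Γ Δ} → GT⁻ (bot ∷ Γ) Δ
  L¬    : ∀ {Γ Δ α} → Classical α → GT⁻ Γ (α ∷ Δ) → GT⁻ (neg α ∷ Γ) Δ
  R¬    : ∀ {Γ Δ α} → Classical α → GT⁻ (α ∷ Γ) Δ → GT⁻ Γ (neg α ∷ Δ)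
  L∧    : ∀ {Γ Δ φ ψ} → GT⁻ (φ ∷ ψ ∷ Γ) Δ → GT⁻ ((φ ∧' ψ) ∷ Γ) Δ
  R∧    : ∀ {Γ Λ Δ φ ψ} → All Classical Λ →
          GT⁻ Γ (φ ∷ Λ) → GT⁻ Γ (ψ ∷ Λ) → GT⁻ Γ ((φ ∧' ψ) ∷ Λ ++ Δ)
  L∨    : ∀ {Γ Λ Δ φ ψ} → All Classical Λ →
          GT⁻ (φ ∷ Γ) Λ → GT⁻ (ψ ∷ Γ) Λ → GT⁻ ((φ ∨' ψ) ∷ Γ) (Λ ++ Δ)
  R∨    : ∀ {Γ Δ φ ψ} → GT⁻ Γ (φ ∷ ψ ∷ Δ) → GT⁻ Γ ((φ ∨' ψ) ∷ Δ)
  L⩔    : ∀ {Γ Δ} (χ : Ctx) {φL φR} →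
          GT⁻ (plug χ φL ∷ Γ) Δ → GT⁻ (plug χ φR ∷ Γ) Δ →
          GT⁻ (plug χ (φL ⩔ φR) ∷ Γ) Δ
  R⩔L   : ∀ {Γ Δ} (χ : Ctx) {φL φR} →
          GT⁻ Γ (plug χ φL ∷ Δ) → GT⁻ Γ (plug χ (φL ⩔ φR) ∷ Δ)
  R⩔R   : ∀ {Γ Δ} (χ : Ctx) {φL φR} →
          GT⁻ Γ (plug χ φR ∷ Δ) → GT⁻ Γ (plug χ (φL ⩔ φR) ∷ Δ)

-- Resolving the inquisitive disjunctions of a formula one at a time, choosing a disjunct under
-- a context χ, always ends in classical formulas. On the left, L⩔ can be applied backwards
-- because each disjunct entails the disjunction. Once Γ is classical, every team satisfying Γ
-- lies inside the largest one, {v | v ⊩ Γ}, and that team alone witnesses Γ ⊨ ⋁ Δ. Within a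
-- single team an inquisitive disjunction is decided, so each right-hand ⩔ can be resolved by
-- R⩔ without losing the consequence. What remains is a classical sequent valid under every
-- valuation. The invertible classical rules reduce it to atoms, where the valuation that makes
-- exactly the left atoms true yields an axiom.
module Submission where

open import Defs
open import Data.List using (List)
open import Data.List.Relation.Unary.All using (All)

open import Data.Nat using (ℕ; _≟_)
open import Data.Bool as Bool using (true)
open import Data.Bool.Properties using (T-≡)
open import Data.Empty using (⊥)
open import Data.Product using (_×_; _,_; proj₁; proj₂)
import Data.Product as Product
open import Data.Sum using (_⊎_; inj₁; inj₂)
import Data.Sum as Sum
open import Data.List using ([]; _∷_; _++_; [_]; map)
open import Data.List.Properties using (++-assoc)
open import Data.List.Relation.Unary.All using ([]; _∷_; tabulate)
import Data.List.Relation.Unary.All as All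
open import Data.List.Relation.Unary.All.Properties using (++⁺; map⁺)
open import Data.List.Relation.Unary.Any using (Any; here; there)
import Data.List.Relation.Unary.Any as Any
open import Data.List.Membership.Propositional using (_∈_; find)
open import Data.List.Membership.Propositional.Properties using (∈-map⁺; ∈-∃++)
open import Data.List.Membership.DecPropositional _≟_ using (_∈?_)
open import Data.List.Relation.Binary.Permutation.Propositional
  using (_↭_; ↭-refl; ↭-sym; ↭-trans; ↭-reflexive; prep)
open import Data.List.Relation.Binary.Permutation.Propositional.Properties
  using (shift; ++-identityʳ; All-resp-↭; Any-resp-↭; ∈-resp-↭)
open import Function using (id; _∘_)
open import Function.Bundles using (mk⇔; Equivalence)
open import Level using (lift)
open import Relation.Binary.PropositionalEquality using (_≡_; refl; sym; trans; subst; _≗_)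
open import Relation.Nullary using (¬_; yes; no; isYes; ¬?; _×-dec_; _⊎-dec_; Dec)
open import Relation.Nullary.Decidable using (toWitness; fromWitness)
open import Relation.Unary using (_⊆_; _∩_)

variable
  p : ℕ
  v w : Valuation
  t : Team
  φ ψ θ α β φ₁ φ₂ : Fm
  Γ Γ' Δ Δ' : List Fm

-- The clause for ⩔ is arbitrary: ⊩ is only ever used on classical formulas.
_⊩_ : Valuation → Fm → Set
v ⊩ var p    = v p ≡ true
v ⊩ bot      = ⊥
v ⊩ neg φ    = ¬ (v ⊩ φ)
v ⊩ (φ ∧' ψ) = v ⊩ φ × v ⊩ ψ
v ⊩ (φ ∨' ψ) = v ⊩ φ ⊎ v ⊩ ψ
v ⊩ (φ ⩔ ψ)  = v ⊩ φ ⊎ v ⊩ ψ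

_⊩?_ : ∀ v φ → Dec (v ⊩ φ)
v ⊩? var p    = v p Bool.≟ true
v ⊩? bot      = no id
v ⊩? neg φ    = ¬? (v ⊩? φ)
v ⊩? (φ ∧' ψ) = (v ⊩? φ) ×-dec (v ⊩? ψ)
v ⊩? (φ ∨' ψ) = (v ⊩? φ) ⊎-dec (v ⊩? ψ)
v ⊩? (φ ⩔ ψ)  = (v ⊩? φ) ⊎-dec (v ⊩? ψ)

⊩-resp-≗ : ∀ φ → v ≗ w → v ⊩ φ → w ⊩ φ
⊩-resp-≗ (var p)  v≗w h = trans (sym (v≗w p)) h
⊩-resp-≗ (neg φ)  v≗w h = h ∘ ⊩-resp-≗ φ (sym ∘ v≗w)
⊩-resp-≗ (φ ∧' ψ) v≗w   = Product.map (⊩-resp-≗ φ v≗w) (⊩-resp-≗ ψ v≗w)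
⊩-resp-≗ (φ ∨' ψ) v≗w   = Sum.map (⊩-resp-≗ φ v≗w) (⊩-resp-≗ ψ v≗w)
⊩-resp-≗ (φ ⩔ ψ)  v≗w   = Sum.map (⊩-resp-≗ φ v≗w) (⊩-resp-≗ ψ v≗w)

Valid : List Fm → List Fm → Set
Valid Γ Δ = ∀ v → All (v ⊩_) Γ → Any (v ⊩_) Δ

valid-resp-↭ : Γ ↭ Γ' → Δ ↭ Δ' → Valid Γ Δ → Valid Γ' Δ'
valid-resp-↭ Γ↭Γ' Δ↭Δ' V v vΓ' = Any-resp-↭ Δ↭Δ' (V v (All-resp-↭ (↭-sym Γ↭Γ') vΓ'))

valid-L¬⁻ : Valid (neg α ∷ Γ) Δ → Valid Γ (α ∷ Δ)
valid-L¬⁻ {α} V v vΓ with v ⊩? α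
... | yes vα = here vα
... | no ¬vα = there (V v (¬vα ∷ vΓ))

valid-R¬⁻ : Valid Γ (neg α ∷ Δ) → Valid (α ∷ Γ) Δ
valid-R¬⁻ V v (vα ∷ vΓ) = Any.tail (λ ¬vα → ¬vα vα) (V v vΓ)

valid-L∧⁻ : Valid ((φ ∧' ψ) ∷ Γ) Δ → Valid (φ ∷ ψ ∷ Γ) Δ
valid-L∧⁻ V v (vφ ∷ vψ ∷ vΓ) = V v ((vφ , vψ) ∷ vΓ)

valid-L∨⁻ˡ : Valid ((φ ∨' ψ) ∷ Γ) Δ → Valid (φ ∷ Γ) Δ
valid-L∨⁻ˡ V v (vφ ∷ vΓ) = V v (inj₁ vφ ∷ vΓ)

valid-L∨⁻ʳ : Valid ((φ ∨' ψ) ∷ Γ) Δ → Valid (ψ ∷ Γ) Δ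
valid-L∨⁻ʳ V v (vψ ∷ vΓ) = V v (inj₂ vψ ∷ vΓ)

valid-R∧⁻ˡ : Valid Γ ((φ ∧' ψ) ∷ Δ) → Valid Γ (φ ∷ Δ)
valid-R∧⁻ˡ V v = Any.fromSum ∘ Sum.map₁ proj₁ ∘ Any.toSum ∘ V v

valid-R∧⁻ʳ : Valid Γ ((φ ∧' ψ) ∷ Δ) → Valid Γ (ψ ∷ Δ)
valid-R∧⁻ʳ V v = Any.fromSum ∘ Sum.map₁ proj₂ ∘ Any.toSum ∘ V v

valid-R∨⁻ : Valid Γ ((φ ∨' ψ) ∷ Δ) → Valid Γ (φ ∷ ψ ∷ Δ)
valid-R∨⁻ V v vΓ with V v vΓ
... | here (inj₁ vφ) = here vφ
... | here (inj₂ vψ) = there (here vψ)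
... | there vΔ       = there (there vΔ)

L∨′ : ∀ {Λ} → All Classical Λ → GT⁻ (φ ∷ Γ) Λ → GT⁻ (ψ ∷ Γ) Λ → GT⁻ ((φ ∨' ψ) ∷ Γ) Λ
L∨′ {Λ = Λ} cΛ dφ dψ = perm ↭-refl (++-identityʳ Λ) (L∨ cΛ dφ dψ)

R∧′ : ∀ {Λ} → All Classical Λ → GT⁻ Γ (φ ∷ Λ) → GT⁻ Γ (ψ ∷ Λ) → GT⁻ Γ ((φ ∧' ψ) ∷ Λ)
R∧′ {Λ = Λ} cΛ dφ dψ = perm ↭-refl (prep _ (++-identityʳ Λ)) (R∧ cΛ dφ dψ)

ax∈ : var p ∈ Γ → var p ∈ Δ → GT⁻ Γ Δ
ax∈ p∈Γ p∈Δ with Γ₁ , Γ₂ , refl ← ∈-∃++ p∈Γ | Δ₁ , Δ₂ , refl ← ∈-∃++ p∈Δ =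
  perm (↭-sym (shift _ Γ₁ Γ₂)) (↭-sym (shift _ Δ₁ Δ₂)) (ax _)

data Atomic : Fm → Set where
  a-var : ∀ p → Atomic (var p)
  a-bot : Atomic bot

atomic⇒classical : Atomic φ → Classical φ
atomic⇒classical (a-var p) = c-var p
atomic⇒classical a-bot     = c-bot

indicator : List ℕ → Valuation
indicator A p = isYes (p ∈? A)

-- Decomposing one formula turns Complete of the premises into Complete of the conclusion, so
-- classical completeness follows by structural recursion on formulas, with no size measure.
Complete : List Fm → List Fm → Set
Complete Γ Δ = ∀ A {B} → All Atomic B →
               Valid (Γ ++ map var A) (Δ ++ B) → GT⁻ (Γ ++ map var A) (Δ ++ B)

complete-atomic : Complete [] []
complete-atomic A {B} aB V
  with β , β∈B , vβ ← find (V (indicator A) (map⁺ (tabulate (Equivalence.to T-≡ ∘ fromWitness))))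
  = close (All.lookup aB β∈B) β∈B vβ
  where
  close : Atomic β → β ∈ B → indicator A ⊩ β → GT⁻ (map var A) B
  close (a-var p) p∈B vp = ax∈ (∈-map⁺ var (toWitness {a? = p ∈? A} (Equivalence.from T-≡ vp))) p∈B

atomicʳ : Atomic α → Complete Γ Δ → Complete Γ (α ∷ Δ)
atomicʳ {α} {Δ = Δ} a H A {B} aB V =
  perm ↭-refl (shift α Δ B) (H A (a ∷ aB) (valid-resp-↭ ↭-refl (↭-sym (shift α Δ B)) V))

mutual
  completeˡ : Classical α → All Classical Δ → Complete Γ Δ → Complete (α ∷ Γ) Δ
  completeˡ {Γ = Γ} (c-var p) cΔ H A aB V =
    perm (shift (var p) Γ (map var A)) ↭-refl
      (H (p ∷ A) aB (valid-resp-↭ (↭-sym (shift (var p) Γ (map var A))) ↭-refl V))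
  completeˡ c-bot       cΔ H A aB V = ax⊥
  completeˡ (c-neg c)   cΔ H A aB V = L¬ c (completeʳ c cΔ H A aB (valid-L¬⁻ V))
  completeˡ (c-and c d) cΔ H A aB V = L∧ (completeˡ c cΔ (completeˡ d cΔ H) A aB (valid-L∧⁻ V))
  completeˡ (c-or c d)  cΔ H A aB V =
    L∨′ (++⁺ cΔ (All.map atomic⇒classical aB))
      (completeˡ c cΔ H A aB (valid-L∨⁻ˡ V)) (completeˡ d cΔ H A aB (valid-L∨⁻ʳ V))

  completeʳ : Classical α → All Classical Δ → Complete Γ Δ → Complete Γ (α ∷ Δ)
  completeʳ (c-var p)   cΔ H          = atomicʳ (a-var p) H
  completeʳ c-bot       cΔ H          = atomicʳ a-bot H
  completeʳ (c-neg c)   cΔ H A aB V = R¬ c (completeˡ c cΔ H A aB (valid-R¬⁻ V))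
  completeʳ (c-and c d) cΔ H A aB V =
    R∧′ (++⁺ cΔ (All.map atomic⇒classical aB))
      (completeʳ c cΔ H A aB (valid-R∧⁻ˡ V)) (completeʳ d cΔ H A aB (valid-R∧⁻ʳ V))
  completeʳ (c-or c d)  cΔ H A aB V = R∨ (completeʳ c (d ∷ cΔ) (completeʳ d cΔ H) A aB (valid-R∨⁻ V))

complete : All Classical Γ → All Classical Δ → Complete Γ Δ
complete []        []        = complete-atomic
complete []        (d ∷ cΔ) = completeʳ d cΔ (complete [] cΔ)
complete (c ∷ cΓ) cΔ        = completeˡ c cΔ (complete cΓ cΔ)

classical-completeness : All Classical Γ → All Classical Δ → Valid Γ Δ → GT⁻ Γ Δ
classical-completeness {Γ} {Δ} cΓ cΔ V =
  perm (++-identityʳ Γ) (++-identityʳ Δ)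
    (complete cΓ cΔ [] [] (valid-resp-↭ (↭-sym (++-identityʳ Γ)) (↭-sym (++-identityʳ Δ)) V))

mutual
  ⊨⇒⊩ : Classical α → t ⊨ α → t ⊆ (_⊩ α)
  ⊨⇒⊩ (c-var p)     (lift h)  tv = h _ tv
  ⊨⇒⊩ c-bot         (lift h)  tv = h _ tv
  ⊨⇒⊩ (c-neg {α} c) h {v}     tv = λ vα → h v tv (⊩⇒⊨ c λ w≗v → ⊩-resp-≗ α (sym ∘ w≗v) vα)
  ⊨⇒⊩ (c-and c d)   (hα , hβ) tv = ⊨⇒⊩ c hα tv , ⊨⇒⊩ d hβ tv
  ⊨⇒⊩ (c-or c d)    (s , u , t⇔s∪u , hs , hu) tv =
    Sum.map (⊨⇒⊩ c hs) (⊨⇒⊩ d hu) (Equivalence.to (t⇔s∪u _) tv)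

  ⊩⇒⊨ : Classical α → t ⊆ (_⊩ α) → t ⊨ α
  ⊩⇒⊨ (c-var p)   h = lift λ _ → h
  ⊩⇒⊨ c-bot       h = lift λ _ → h
  ⊩⇒⊨ (c-neg c)   h = λ v tv sα → h tv (⊨⇒⊩ c sα λ _ → refl)
  ⊩⇒⊨ (c-and c d) h = ⊩⇒⊨ c (proj₁ ∘ h) , ⊩⇒⊨ d (proj₂ ∘ h)
  ⊩⇒⊨ {α ∨' β} {t} (c-or c d) h =
    t ∩ (_⊩ α) , t ∩ (_⊩ β) ,
    (λ v → mk⇔ (λ tv → Sum.map (tv ,_) (tv ,_) (h tv)) Sum.[ proj₁ , proj₁ ]) ,
    ⊩⇒⊨ c proj₂ , ⊩⇒⊨ d proj₂

⋁-classical : All Classical Δ → Classical (⋁ Δ)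
⋁-classical []                = c-bot
⋁-classical (c ∷ [])          = c
⋁-classical (c ∷ cΔ@(_ ∷ _)) = c-or c (⋁-classical cΔ)

⊩-⋁⁻ : ∀ Δ → v ⊩ ⋁ Δ → Any (v ⊩_) Δ
⊩-⋁⁻ (φ ∷ [])     h = here h
⊩-⋁⁻ (φ ∷ ψ ∷ Δ) h = Any.fromSum (Sum.map₂ (⊩-⋁⁻ (ψ ∷ Δ)) h)

plug-⊎ : ∀ χ → (∀ {t} → t ⊨ φ → t ⊨ φ₁ ⊎ t ⊨ φ₂) →
         t ⊨ plug χ φ → t ⊨ plug χ φ₁ ⊎ t ⊨ plug χ φ₂
plug-⊎ hole     f h                      = f h
plug-⊎ (χ ∧ˡ ψ) f (h , hψ)               = Sum.map (_, hψ) (_, hψ) (plug-⊎ χ f h)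
plug-⊎ (ψ ∧ʳ χ) f (hψ , h)               = Sum.map (hψ ,_) (hψ ,_) (plug-⊎ χ f h)
plug-⊎ (χ ∨ˡ ψ) f (s , u , e , hs , hu) =
  Sum.map (λ h → s , u , e , h , hu) (λ h → s , u , e , h , hu) (plug-⊎ χ f hs)
plug-⊎ (ψ ∨ʳ χ) f (s , u , e , hs , hu) =
  Sum.map (λ h → s , u , e , hs , h) (λ h → s , u , e , hs , h) (plug-⊎ χ f hu)
plug-⊎ (χ ⩔ˡ ψ) f (inj₁ h)               = Sum.map inj₁ inj₁ (plug-⊎ χ f h)
plug-⊎ (χ ⩔ˡ ψ) f (inj₂ h)               = inj₁ (inj₂ h)
plug-⊎ (ψ ⩔ʳ χ) f (inj₁ h)               = inj₁ (inj₁ h)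
plug-⊎ (ψ ⩔ʳ χ) f (inj₂ h)               = Sum.map inj₂ inj₂ (plug-⊎ χ f h)

plug-mono : ∀ χ → (∀ {t} → t ⊨ φ → t ⊨ ψ) → t ⊨ plug χ φ → t ⊨ plug χ ψ
plug-mono χ f = Sum.reduce ∘ plug-⊎ χ (inj₁ ∘ f)

⋁-⊎ : ∀ Δ₁ Δ₂ → (∀ {t} → t ⊨ φ → t ⊨ φ₁ ⊎ t ⊨ φ₂) →
      t ⊨ ⋁ (Δ₁ ++ φ ∷ Δ₂) → t ⊨ ⋁ (Δ₁ ++ φ₁ ∷ Δ₂) ⊎ t ⊨ ⋁ (Δ₁ ++ φ₂ ∷ Δ₂)
⋁-⊎ []             []       f = f
⋁-⊎ []             (ψ ∷ Δ₂) f = plug-⊎ (hole ∨ˡ ⋁ (ψ ∷ Δ₂)) f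
⋁-⊎ (ψ ∷ [])       Δ₂       f = plug-⊎ (ψ ∨ʳ hole) (⋁-⊎ [] Δ₂ f)
⋁-⊎ (ψ ∷ ψ' ∷ Δ₁) Δ₂       f = plug-⊎ (ψ ∨ʳ hole) (⋁-⊎ (ψ' ∷ Δ₁) Δ₂ f)

⊨ˢ-resp-↭ : Γ ↭ Γ' → Γ ⊨ˢ φ → Γ' ⊨ˢ φ
⊨ˢ-resp-↭ Γ↭Γ' E t tΓ' = E t λ γ γ∈Γ → tΓ' γ (∈-resp-↭ Γ↭Γ' γ∈Γ)

⊨ˢ-strengthen : (∀ {t} → t ⊨ φ → t ⊨ ψ) → (ψ ∷ Γ) ⊨ˢ θ → (φ ∷ Γ) ⊨ˢ θ
⊨ˢ-strengthen f E t tΓ = E t λ where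
  _ (here refl)  → f (tΓ _ (here refl))
  γ (there γ∈Γ) → tΓ γ (there γ∈Γ)

maxTeam : List Fm → Team
maxTeam Γ v = All (v ⊩_) Γ

maxTeam-⊨ : All Classical Γ → Γ ⊨ˢ φ → maxTeam Γ ⊨ φ
maxTeam-⊨ cΓ E = E (maxTeam _) λ γ γ∈Γ → ⊩⇒⊨ (All.lookup cΓ γ∈Γ) λ vΓ → All.lookup vΓ γ∈Γ

maxTeam-valid : All Classical Δ → maxTeam Γ ⊨ ⋁ Δ → Valid Γ Δ
maxTeam-valid {Δ} cΔ h v vΓ = ⊩-⋁⁻ Δ (⊨⇒⊩ (⋁-classical cΔ) h vΓ)

-- A tree of choices of a disjunct under a context, with classical leaves; it replaces an
-- induction on the number of ⩔ in a formula.
data Resolvable : Fm → Set where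
  classical : Classical φ → Resolvable φ
  split     : ∀ χ → Resolvable (plug χ φ₁) → Resolvable (plug χ φ₂) →
              Resolvable (plug χ (φ₁ ⩔ φ₂))

∧-resolvable : Resolvable φ → Resolvable ψ → Resolvable (φ ∧' ψ)
∧-resolvable {ψ = ψ} (split χ r s) q = split (χ ∧ˡ ψ) (∧-resolvable r q) (∧-resolvable s q)
∧-resolvable {φ}  (classical c) (split χ r s) =
  split (φ ∧ʳ χ) (∧-resolvable (classical c) r) (∧-resolvable (classical c) s)
∧-resolvable (classical c) (classical d) = classical (c-and c d)

∨-resolvable : Resolvable φ → Resolvable ψ → Resolvable (φ ∨' ψ)
∨-resolvable {ψ = ψ} (split χ r s) q = split (χ ∨ˡ ψ) (∨-resolvable r q) (∨-resolvable s q)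
∨-resolvable {φ}  (classical c) (split χ r s) =
  split (φ ∨ʳ χ) (∨-resolvable (classical c) r) (∨-resolvable (classical c) s)
∨-resolvable (classical c) (classical d) = classical (c-or c d)

wf⇒resolvable : WF φ → Resolvable φ
wf⇒resolvable (w-var p)   = classical (c-var p)
wf⇒resolvable w-bot       = classical c-bot
wf⇒resolvable (w-neg c)   = classical (c-neg c)
wf⇒resolvable (w-and p q) = ∧-resolvable (wf⇒resolvable p) (wf⇒resolvable q)
wf⇒resolvable (w-or p q)  = ∨-resolvable (wf⇒resolvable p) (wf⇒resolvable q)
wf⇒resolvable (w-ior p q) = split hole (wf⇒resolvable p) (wf⇒resolvable q)

resolveˡ : (P : Fm → Set₁) →
           (∀ χ {φ₁ φ₂} → P (plug χ (φ₁ ⩔ φ₂)) → P (plug χ φ₁) × P (plug χ φ₂)) →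
           Resolvable φ → P φ → (∀ {α} → Classical α → P α → GT⁻ (α ∷ Γ) Δ) →
           GT⁻ (φ ∷ Γ) Δ
resolveˡ P P-⩔⁻ (classical c) pφ k = k c pφ
resolveˡ P P-⩔⁻ (split χ r s) pφ k =
  L⩔ χ (resolveˡ P P-⩔⁻ r (proj₁ (P-⩔⁻ χ pφ)) k) (resolveˡ P P-⩔⁻ s (proj₂ (P-⩔⁻ χ pφ)) k)

resolveʳ : (P : Fm → Set₁) →
           (∀ χ {φ₁ φ₂} → P (plug χ (φ₁ ⩔ φ₂)) → P (plug χ φ₁) ⊎ P (plug χ φ₂)) →
           Resolvable φ → P φ → (∀ {α} → Classical α → P α → GT⁻ Γ (α ∷ Δ)) →
           GT⁻ Γ (φ ∷ Δ)
resolveʳ P P-⩔⁻ (classical c) pφ k = k c pφ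
resolveʳ P P-⩔⁻ (split χ r s) pφ k with P-⩔⁻ χ pφ
... | inj₁ pφ₁ = R⩔L χ (resolveʳ P P-⩔⁻ r pφ₁ k)
... | inj₂ pφ₂ = R⩔R χ (resolveʳ P P-⩔⁻ s pφ₂ k)

resolveˡ* : All Resolvable Γ → Γ ⊨ˢ ⋁ Δ →
            (∀ {Γ'} → All Classical Γ' → Γ' ⊨ˢ ⋁ Δ → GT⁻ Γ' Δ) → GT⁻ Γ Δ
resolveˡ* {Δ = Δ} rΓ E k = go [] rΓ E
  where
  go : ∀ {Γc Γ} → All Classical Γc → All Resolvable Γ → (Γc ++ Γ) ⊨ˢ ⋁ Δ → GT⁻ (Γc ++ Γ) Δ
  go cΓc []       E = k (++⁺ cΓc []) E
  go {Γc} {φ ∷ Γ} cΓc (r ∷ rΓ) E =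
    perm (↭-sym (shift φ Γc Γ)) ↭-refl
      (resolveˡ (λ ψ → (ψ ∷ Γc ++ Γ) ⊨ˢ ⋁ Δ)
        (λ χ E' → ⊨ˢ-strengthen (plug-mono χ inj₁) E' , ⊨ˢ-strengthen (plug-mono χ inj₂) E')
        r (⊨ˢ-resp-↭ (shift φ Γc Γ) E) λ c → go (c ∷ cΓc) rΓ)

resolveʳ* : ∀ {T} → All Resolvable Δ → T ⊨ ⋁ Δ →
            (∀ {Δ'} → All Classical Δ' → T ⊨ ⋁ Δ' → GT⁻ Γ Δ') → GT⁻ Γ Δ
resolveʳ* {Γ = Γ} {T} rΔ h k = go [] rΔ h
  where
  go : ∀ {Δc Δ} → All Classical Δc → All Resolvable Δ → T ⊨ ⋁ (Δc ++ Δ) → GT⁻ Γ (Δc ++ Δ)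
  go cΔc []       h = k (++⁺ cΔc []) h
  go {Δc} {φ ∷ Δ} cΔc (r ∷ rΔ) h =
    perm ↭-refl (↭-sym (shift φ Δc Δ))
      (resolveʳ (λ ψ → T ⊨ ⋁ (Δc ++ ψ ∷ Δ)) (λ χ → ⋁-⊎ Δc Δ (plug-⊎ χ id)) r h λ {α} c hα →
        perm ↭-refl (↭-trans (↭-reflexive (++-assoc Δc [ α ] Δ)) (shift α Δc Δ))
          (go (++⁺ cΔc (c ∷ [])) rΔ (subst (λ Θ → T ⊨ ⋁ Θ) (sym (++-assoc Δc [ α ] Δ)) hα)))

mainTheorem5 : (Γ Δ : List Fm) → All WF Γ → All WF Δ →
               Γ ⊨ˢ ⋁ Δ → GT⁻ Γ Δ
mainTheorem5 Γ Δ wΓ wΔ Γ⊨Δ =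
  resolveˡ* (All.map wf⇒resolvable wΓ) Γ⊨Δ λ cΓ' Γ'⊨Δ →
  resolveʳ* (All.map wf⇒resolvable wΔ) (maxTeam-⊨ cΓ' Γ'⊨Δ) λ cΔ' T⊨Δ' →
  classical-completeness cΓ' cΔ' (maxTeam-valid cΔ' T⊨Δ')
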